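{- Let $B=(b_{st})$ be an $n\times n$ complex matrix and $1\le k\le n$. Then $$\sum_{1\le i,j\le n}d_{(k,1^{n-k})}(B_{(ij)})=n\,d_{(k,1^{n-k})}(B).$$
   Context: For a partition $\lambda$ of $n$ with irreducible character $\chi_\lambda$ of $S_n$, $d_\lambda(B)=\sum_{\sigma\in S_n}\chi_\lambda(\sigma)\prod_{i=1}^n b_{i\sigma(i)}$. For $1\le i,j\le n$, $B_{(ij)}=(c_{st})$ is the matrix with $c_{ij}=b_{ij}$, $c_{st}=b_{st}$ whenever $s\ne i$ and $t\ne j$, and $c_{st}=0$ otherwise (i.e. all entries of row $i$ and column $j$ other than the $(i,j)$ entry are set to $0$). -}

module Defs where

open import Level using (Level)
open import Algebra.Bundles using (CommutativeRing)
open import Data.Bool using (Bool; true; false; _∧_; _∨_; not; if_then_else_)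
open import Data.Nat using (ℕ; zero; suc; _∸_; _<ᵇ_; _≡ᵇ_) renaming (_+_ to _+ℕ_)
open import Data.Fin using (Fin; toℕ)
import Data.Fin as Fin
open import Data.List using (List; []; _∷_; map; foldr; filter; concatMap; replicate; length; upTo)
open import Data.Fin.Properties using () renaming (_≟_ to _≟F_)
open import Relation.Nullary.Decidable using (⌊_⌋)

allFin : (n : ℕ) → List (Fin n)
allFin zero = []
allFin (suc n) = Fin.zero ∷ map Fin.suc (allFin n)

all : {A : Set} → (A → Bool) → List A → Bool
all p = foldr (λ x b → p x ∧ b) true

any : {A : Set} → (A → Bool) → List A → Bool
any p = foldr (λ x b → p x ∨ b) false

_==F_ : {n : ℕ} → Fin n → Fin n → Bool
i ==F j = ⌊ i ≟F j ⌋

consF : {n m : ℕ} → Fin m → (Fin n → Fin m) → (Fin (suc n) → Fin m)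
consF j f Fin.zero = j
consF j f (Fin.suc i) = f i

allFuns : (n m : ℕ) → List (Fin n → Fin m)
allFuns zero m = (λ ()) ∷ []
allFuns (suc n) m = concatMap (λ f → map (λ j → consF j f) (allFin m)) (allFuns n m)

-- injectivity test; an injective map Fin n → Fin n is a permutation in S_n
isInjective : {n : ℕ} → (Fin n → Fin n) → Bool
isInjective {n} f =
  all (λ i → all (λ j → not (f i ==F f j) ∨ (i ==F j)) (allFin n)) (allFin n)

iter : {n : ℕ} → (Fin n → Fin n) → ℕ → Fin n → Fin n
iter f zero x = x
iter f (suc t) x = f (iter f t x)

-- least t ∈ {1,…,n} with f^t(i) = i (the length of the cycle of i)
cycleLenFrom : {n : ℕ} → (Fin n → Fin n) → Fin n → ℕ → ℕ → ℕ
cycleLenFrom f i t zero = t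
cycleLenFrom f i t (suc fuel) =
  if iter f t i ==F i then t else cycleLenFrom f i (suc t) fuel

cycleLen : {n : ℕ} → (Fin n → Fin n) → Fin n → ℕ
cycleLen {n} f i = cycleLenFrom f i 1 n

isCycleMin : {n : ℕ} → (Fin n → Fin n) → Fin n → Bool
isCycleMin {n} f i = all (λ t → not (toℕ (iter f t i) <ᵇ toℕ i)) (upTo n)

cycleType : {n : ℕ} → (Fin n → Fin n) → List ℕ
cycleType {n} f = map (cycleLen f) (filter (λ i → isCycleMin f i Data.Bool.≟ true) (allFin n))
  where import Data.Bool

-- beta-set (first column hook lengths) of a partition λ₁ ≥ … ≥ λₘ:
-- βᵢ = λᵢ + (m - i)
betaSet : List ℕ → List ℕ
betaSet [] = []
betaSet (x ∷ xs) = (x +ℕ length xs) ∷ betaSet xs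

_∈ᵇ_ : ℕ → List ℕ → Bool
x ∈ᵇ xs = any (λ y → x ≡ᵇ y) xs

-- number of elements c of β with a < c < b (the leg length of a rim hook)
between : ℕ → ℕ → List ℕ → ℕ
between a b [] = 0
between a b (c ∷ cs) = (if (a <ᵇ c) ∧ (c <ᵇ b) then 1 else 0) +ℕ between a b cs

replaceℕ : ℕ → ℕ → List ℕ → List ℕ
replaceℕ b b' = map (λ c → if c ≡ᵇ b then b' else c)

module Imm {c ℓ : Level} (R : CommutativeRing c ℓ) where
  open CommutativeRing R

  sumR : List Carrier → Carrier
  sumR = foldr _+_ 0#

  sumFin : (n : ℕ) → (Fin n → Carrier) → Carrier
  sumFin n g = sumR (map g (allFin n))

  prodFin : (n : ℕ) → (Fin n → Carrier) → Carrier
  prodFin n g = foldr _*_ 1# (map g (allFin n))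

  _·_ : ℕ → Carrier → Carrier
  zero · x = 0#
  suc n · x = x + (n · x)

  signR : ℕ → Carrier
  signR zero = 1#
  signR (suc h) = - signR h

  -- Irreducible character χ_λ(ρ) of the symmetric group via the
  -- Murnaghan–Nakayama rule, on beta-sets: removing a rim hook of
  -- length r moves a bead b ∈ β to the free position b - r, with sign
  -- (-1)^(number of beads strictly between).
  -- β : beta-set of size m; ρ : list of cycle lengths.
  mn : ℕ → List ℕ → List ℕ → Carrier
  mn m β [] = if all (λ b → b <ᵇ m) β then 1# else 0#
  mn m β (r ∷ ρ) =
    sumR (map (λ b → if (r ∸ 1 <ᵇ b) ∧ not ((b ∸ r) ∈ᵇ β)
                      then signR (between (b ∸ r) b β) * mn m (replaceℕ b (b ∸ r) β) ρ
                      else 0#) β)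

  -- χ_λ evaluated at a permutation σ of Fin n (λ a partition given as a
  -- weakly decreasing list of positive parts)
  χ : (λ' : List ℕ) → {n : ℕ} → (Fin n → Fin n) → Carrier
  χ λ' σ = mn (length λ') (betaSet λ') (cycleType σ)

  Matrix : ℕ → Set c
  Matrix n = Fin n → Fin n → Carrier

  -- immanant d_λ(B) = Σ_{σ ∈ S_n} χ_λ(σ) ∏ᵢ b_{i σ(i)}
  d : (λ' : List ℕ) → {n : ℕ} → Matrix n → Carrier
  d λ' {n} B = sumR (map (λ σ → if isInjective σ
                                  then χ λ' σ * prodFin n (λ i → B i (σ i))
                                  else 0#) (allFuns n n))

  -- B_(ij): keep b_ij, keep b_st for s ≠ i and t ≠ j, all other entries 0
  sub : {n : ℕ} → Matrix n → Fin n → Fin n → Matrix n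
  sub B i j s t =
    if (s ==F i) ∧ (t ==F j) then B i j
    else if not (s ==F i) ∧ not (t ==F j) then B s t
    else 0#

hook : ℕ → ℕ → List ℕ
hook n k = k ∷ replicate (n ∸ k) 1

{-# OPTIONS --safe #-}
-- For a fixed row i, the term of σ survives
-- in d(B_(ij)) exactly when σ(i) = j, and then it equals the term of σ in d(B): since σ is a
-- bijection, s = i holds iff σ(s) = j, so σ never meets an entry of B_(ij) that was set to 0.
-- Hence the sum over j of d(B_(ij)) is d(B) for each i, and the sum over i gives n d(B).
module Submission where

open import Defs
open import Algebra.Bundles using (CommutativeRing)
open import Data.Bool using (Bool; true; false; _∧_; _∨_; not; if_then_else_)
open import Data.Bool.Properties using (T-≡)
open import Data.Fin using (Fin; zero; suc)
open import Data.Fin.Properties using (suc-injective) renaming (_≟_ to _≟F_)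
open import Data.List using (List; []; _∷_; map; foldr)
open import Data.List.Properties using (map-∘)
open import Data.Nat using (ℕ; _≤_)
open import Function using (_∘_; Injective)
open import Function.Bundles using (Equivalence)
open import Relation.Binary.PropositionalEquality using (_≡_; _≢_; refl; sym; trans; cong)
open import Relation.Nullary using (yes; no; contradiction)
open import Relation.Nullary.Decidable using (toWitness)
import Algebra.Properties.CommutativeSemigroup as CommutativeSemigroupProperties
import Relation.Binary.Reasoning.Setoid as SetoidReasoning

==F-refl : ∀ {n} (a : Fin n) → a ==F a ≡ true
==F-refl a with a ≟F a
... | yes _ = refl
... | no a≢a = contradiction refl a≢a

==F-≢ : ∀ {n} {a b : Fin n} → a ≢ b → a ==F b ≡ false
==F-≢ {a = a} {b} a≢b with a ≟F b
... | yes a≡b = contradiction a≡b a≢b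
... | no _ = refl

==F-sound : ∀ {n} {a b : Fin n} → a ==F b ≡ true → a ≡ b
==F-sound a==b = toWitness (Equivalence.from T-≡ a==b)

==F-injective : ∀ {n} {σ : Fin n → Fin n} → Injective _≡_ _≡_ σ →
                ∀ a b → a ==F b ≡ σ a ==F σ b
==F-injective {σ = σ} σ-inj a b with a ≟F b
... | yes refl = sym (==F-refl (σ a))
... | no a≢b = sym (==F-≢ (a≢b ∘ σ-inj))

all-map : ∀ {A B : Set} (p : B → Bool) (f : A → B) (xs : List A) →
          all p (map f xs) ≡ all (p ∘ f) xs
all-map p f [] = refl
all-map p f (x ∷ xs) = cong (p (f x) ∧_) (all-map p f xs)

all-allFin : ∀ {n} (p : Fin n → Bool) → all p (allFin n) ≡ true → ∀ x → p x ≡ true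
all-allFin {ℕ.suc n} p h x with p zero in p0
all-allFin {ℕ.suc n} p () x | false
all-allFin {ℕ.suc n} p h zero | true = p0
all-allFin {ℕ.suc n} p h (suc x) | true =
  all-allFin (p ∘ suc) (trans (sym (all-map p suc (allFin n))) h) x

isInjective-sound : ∀ {n} {σ : Fin n → Fin n} → isInjective σ ≡ true → Injective _≡_ _≡_ σ
isInjective-sound {σ = σ} h {a} {b} σa≡σb = ==F-sound (modus-ponens σa==σb clause)
  where
  clause : not (σ a ==F σ b) ∨ (a ==F b) ≡ true
  clause = all-allFin _ (all-allFin _ h a) b

  σa==σb : σ a ==F σ b ≡ true
  σa==σb = trans (cong (σ a ==F_) (sym σa≡σb)) (==F-refl (σ a))

  modus-ponens : ∀ {x y} → x ≡ true → not x ∨ y ≡ true → y ≡ true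
  modus-ponens refl y≡true = y≡true

module ImmanantSum {c ℓ} (R : CommutativeRing c ℓ) where
  open CommutativeRing R hiding (zero) renaming (refl to ≈-refl; sym to ≈-sym; trans to ≈-trans)
  open Imm R
  open CommutativeSemigroupProperties +-commutativeSemigroup using (interchange)
  open SetoidReasoning setoid

  sum-cong : ∀ {A : Set} {f g : A → Carrier} (xs : List A) →
             (∀ x → f x ≈ g x) → sumR (map f xs) ≈ sumR (map g xs)
  sum-cong [] f≈g = ≈-refl
  sum-cong (x ∷ xs) f≈g = +-cong (f≈g x) (sum-cong xs f≈g)

  sum-zero : ∀ {A : Set} {f : A → Carrier} (xs : List A) →
             (∀ x → f x ≈ 0#) → sumR (map f xs) ≈ 0#
  sum-zero [] f≈0 = ≈-refl
  sum-zero (x ∷ xs) f≈0 = ≈-trans (+-cong (f≈0 x) (sum-zero xs f≈0)) (+-identityˡ 0#)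

  sum-distrib-+ : ∀ {A : Set} (f g : A → Carrier) (xs : List A) →
                  sumR (map (λ x → f x + g x) xs) ≈ sumR (map f xs) + sumR (map g xs)
  sum-distrib-+ f g [] = ≈-sym (+-identityˡ 0#)
  sum-distrib-+ f g (x ∷ xs) =
    ≈-trans (+-congˡ (sum-distrib-+ f g xs)) (interchange (f x) (g x) _ _)

  sum-comm : ∀ {A B : Set} (f : A → B → Carrier) (xs : List A) (ys : List B) →
             sumR (map (λ x → sumR (map (f x) ys)) xs) ≈ sumR (map (λ y → sumR (map (λ x → f x y) xs)) ys)
  sum-comm f [] ys = ≈-sym (sum-zero ys (λ _ → ≈-refl))
  sum-comm f (x ∷ xs) ys =
    ≈-trans (+-congˡ (sum-comm f xs ys)) (≈-sym (sum-distrib-+ (f x) _ ys))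

  sumFin-suc : ∀ n (f : Fin (ℕ.suc n) → Carrier) → sumFin (ℕ.suc n) f ≈ f zero + sumFin n (f ∘ suc)
  sumFin-suc n f = +-congˡ (reflexive (cong sumR (sym (map-∘ (allFin n)))))

  sumFin-const : ∀ n (x : Carrier) → sumFin n (λ _ → x) ≈ n · x
  sumFin-const ℕ.zero x = ≈-refl
  sumFin-const (ℕ.suc n) x = ≈-trans (sumFin-suc n _) (+-congˡ (sumFin-const n x))

  sumFin-single : ∀ n (f : Fin n → Carrier) (a : Fin n) →
                  (∀ j → j ≢ a → f j ≈ 0#) → sumFin n f ≈ f a
  sumFin-single (ℕ.suc n) f zero off = begin
    sumFin (ℕ.suc n) f           ≈⟨ sumFin-suc n f ⟩
    f zero + sumFin n (f ∘ suc)  ≈⟨ +-congˡ (sum-zero (allFin n) (λ j → off (suc j) λ ())) ⟩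
    f zero + 0#                  ≈⟨ +-identityʳ (f zero) ⟩
    f zero                       ∎
  sumFin-single (ℕ.suc n) f (suc a) off = begin
    sumFin (ℕ.suc n) f           ≈⟨ sumFin-suc n f ⟩
    f zero + sumFin n (f ∘ suc)  ≈⟨ +-cong (off zero λ ()) (sumFin-single n (f ∘ suc) a off-suc) ⟩
    0# + f (suc a)               ≈⟨ +-identityˡ (f (suc a)) ⟩
    f (suc a)                    ∎
    where
    off-suc : ∀ j → j ≢ a → f (suc j) ≈ 0#
    off-suc j j≢a = off (suc j) (j≢a ∘ suc-injective)

  prodFin-cong : ∀ n {f g : Fin n → Carrier} → (∀ x → f x ≈ g x) → prodFin n f ≈ prodFin n g
  prodFin-cong n {f} {g} f≈g = go (allFin n)
    where
    go : (xs : List (Fin n)) → foldr _*_ 1# (map f xs) ≈ foldr _*_ 1# (map g xs)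
    go [] = ≈-refl
    go (x ∷ xs) = *-cong (f≈g x) (go xs)

  prodFin-zero : ∀ n (f : Fin n → Carrier) (a : Fin n) → f a ≈ 0# → prodFin n f ≈ 0#
  prodFin-zero (ℕ.suc n) f zero fa≈0 = ≈-trans (*-congʳ fa≈0) (zeroˡ _)
  prodFin-zero (ℕ.suc n) f (suc a) fa≈0 = begin
    prodFin (ℕ.suc n) f           ≈⟨ *-congˡ (reflexive (cong (foldr _*_ 1#) (sym (map-∘ (allFin n))))) ⟩
    f zero * prodFin n (f ∘ suc)  ≈⟨ *-congˡ (prodFin-zero n (f ∘ suc) a fa≈0) ⟩
    f zero * 0#                   ≈⟨ zeroʳ (f zero) ⟩
    0#                            ∎

  sub-kept : ∀ {n} (B : Matrix n) (i j s t : Fin n) → s ==F i ≡ t ==F j → sub B i j s t ≈ B s t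
  sub-kept B i j s t agree with s ==F i in s==i | t ==F j in t==j
  sub-kept B i j s t refl | true | true
    rewrite ==F-sound s==i | ==F-sound t==j = ≈-refl
  sub-kept B i j s t refl | false | false = ≈-refl

  sub-dropped : ∀ {n} (B : Matrix n) (i j t : Fin n) → t ≢ j → sub B i j i t ≈ 0#
  sub-dropped B i j t t≢j rewrite ==F-refl i | ==F-≢ t≢j = ≈-refl

  permutationTerm : ∀ {n} → ((Fin n → Fin n) → Carrier) → Matrix n → (Fin n → Fin n) → Carrier
  permutationTerm {n} w B σ = if isInjective σ then w σ * prodFin n (λ s → B s (σ s)) else 0#

  sum-permutationTerm-sub : ∀ {n} (w : (Fin n → Fin n) → Carrier) (B : Matrix n) (i : Fin n) σ →
    sumFin n (λ j → permutationTerm w (sub B i j) σ) ≈ permutationTerm w B σ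
  sum-permutationTerm-sub {n} w B i σ with isInjective σ in σ-isInjective
  ... | false = sum-zero (allFin n) (λ _ → ≈-refl)
  ... | true = begin
    sumFin n (λ j → w σ * prodFin n (λ s → sub B i j s (σ s)))  ≈⟨ sumFin-single n _ (σ i) off-diagonal ⟩
    w σ * prodFin n (λ s → sub B i (σ i) s (σ s))              ≈⟨ *-congˡ (prodFin-cong n on-diagonal) ⟩
    w σ * prodFin n (λ s → B s (σ s))                          ∎
    where
    σ-injective : Injective _≡_ _≡_ σ
    σ-injective = isInjective-sound σ-isInjective

    on-diagonal : ∀ s → sub B i (σ i) s (σ s) ≈ B s (σ s)
    on-diagonal s = sub-kept B i (σ i) s (σ s) (==F-injective σ-injective s i)

    off-diagonal : ∀ j → j ≢ σ i → w σ * prodFin n (λ s → sub B i j s (σ s)) ≈ 0#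
    off-diagonal j j≢σi =
      ≈-trans (*-congˡ (prodFin-zero n _ i (sub-dropped B i j (σ i) (j≢σi ∘ sym)))) (zeroʳ (w σ))

  sum-d-sub : ∀ (λ' : List ℕ) n (B : Matrix n) →
              sumFin n (λ i → sumFin n (λ j → d λ' (sub B i j))) ≈ n · d λ' B
  sum-d-sub λ' n B = begin
    sumFin n (λ i → sumFin n (λ j → sumR (map (term (sub B i j)) σs)))
      ≈⟨ sum-cong (allFin n) (λ i → sum-comm (λ j → term (sub B i j)) (allFin n) σs) ⟩
    sumFin n (λ i → sumR (map (λ σ → sumFin n (λ j → term (sub B i j) σ)) σs))
      ≈⟨ sum-cong (allFin n) (λ i → sum-cong σs (sum-permutationTerm-sub (χ λ') B i)) ⟩
    sumFin n (λ _ → d λ' B)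
      ≈⟨ sumFin-const n (d λ' B) ⟩
    n · d λ' B
      ∎
    where
    σs : List (Fin n → Fin n)
    σs = allFuns n n

    term : Matrix n → (Fin n → Fin n) → Carrier
    term = permutationTerm (χ λ')

lemma3p1 : ∀ {c ℓ} (R : CommutativeRing c ℓ) → let open CommutativeRing R in let open Imm R in
    (n k : ℕ) → 1 ≤ k → k ≤ n → (B : Matrix n) →
    sumFin n (λ i → sumFin n (λ j → d (hook n k) (sub B i j))) ≈ n · d (hook n k) B
lemma3p1 R n k _ _ B = ImmanantSum.sum-d-sub R (hook n k) n B
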